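{- Let $\mathbb{K}$ be a commutative ring, $n$ a positive integer, and $f:\{1,\ldots,n\}\to\{1,\ldots,n\}$ a map with $f(n)=n$. Let $Z_f=\left(\delta_{i,j}-(1-\delta_{i,n})\delta_{f(i),j}\right)_{1\le i\le n,\ 1\le j\le n}\in\mathbb{K}^{n\times n}$. (a) If $f$ is $n$-potent, then $\det(Z_f)=1$. (b) If $f$ is not $n$-potent, then $\det(Z_f)=0$.
   Context: $\delta_{a,b}$ is $1$ if $a=b$ and $0$ otherwise. A map $f:\{1,\ldots,n\}\to\{1,\ldots,n\}$ is called $n$-potent if for every $i\in\{1,\ldots,n\}$ there exists $k\in\mathbb{N}=\{0,1,2,\ldots\}$ with $f^k(i)=n$ ($f^k$ the $k$-fold composite, $f^0=\mathrm{id}$). -}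

module Defs where

open import Level using (Level)
open import Data.Nat using (ℕ; zero; suc)
open import Data.Fin using (Fin; zero; suc; punchIn; fromℕ; _≟_)
open import Data.Product using (∃-syntax)
open import Relation.Nullary.Decidable using (⌊_⌋)
open import Data.Bool using (if_then_else_)
open import Relation.Binary.PropositionalEquality using (_≡_)
open import Algebra.Bundles using (CommutativeRing)

iter : ∀ {n} → (Fin n → Fin n) → ℕ → Fin n → Fin n
iter f zero    x = x
iter f (suc k) x = f (iter f k x)

-- n-potent, for maps on Fin (suc m) ≅ {1,…,m+1}; the element n is fromℕ m (the last element)
Potent : ∀ m → (Fin (suc m) → Fin (suc m)) → Set
Potent m f = ∀ i → ∃[ k ] iter f k i ≡ fromℕ m

module _ {c ℓ : Level} (R : CommutativeRing c ℓ) where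
  open CommutativeRing R using (Carrier; _+_; _*_; -_; _-_; 0#; 1#)

  ∑ : ∀ n → (Fin n → Carrier) → Carrier
  ∑ zero    g = 0#
  ∑ (suc n) g = g zero + ∑ n (λ j → g (suc j))

  signed : ∀ {n} → Fin n → Carrier → Carrier
  signed zero    x = x
  signed (suc j) x = - signed j x

  det : ∀ n → (Fin n → Fin n → Carrier) → Carrier
  det zero    M = 1#
  det (suc n) M = ∑ (suc n) (λ j → signed j (M zero j * det n (λ i k → M (suc i) (punchIn j k))))

  δ : ∀ {n} → Fin n → Fin n → Carrier
  δ i j = if ⌊ i ≟ j ⌋ then 1# else 0#

  Zmat : ∀ m → (Fin (suc m) → Fin (suc m)) → Fin (suc m) → Fin (suc m) → Carrier
  Zmat m f i j = δ i j - (1# - δ i (fromℕ m)) * δ (f i) j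

{-# OPTIONS --safe #-}

-- For n > 1, row 0 of Z_f is e₀ - e_{f 0}.  If f 0 = 0 that row vanishes, and f is not potent
-- because 0 is a fixed point other than the last element.  Otherwise, with f 0 = a + 1, adding
-- column 0 to column a + 1 turns row 0 into e₀ without changing the determinant, and the Laplace
-- expansion along it leaves exactly Z_g for the map g = contract f a on one point fewer: delete 0
-- and redirect every arrow into 0 to a + 1.  Since g is potent iff f is, both parts follow by
-- induction on the size.
module Submission where

open import Defs
open import Level using (Level; _⊔_)
open import Data.Nat using (ℕ; zero; suc)
import Data.Nat as ℕ
open import Data.Fin using (Fin; fromℕ; zero; suc; punchIn; punchOut; inject₁; _≟_)
open import Data.Fin.Properties using (punchIn-injective; punchIn-punchOut; punchInᵢ≢i; suc-injective)
open import Data.Fin.Induction using (<-weakInduction)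
open import Data.Vec.Functional using (updateAt)
open import Data.Vec.Functional.Properties using (updateAt-updates; updateAt-minimal)
open import Data.Product using (_×_; _,_; ∃-syntax)
open import Data.Empty using (⊥-elim)
open import Function using (_∘_; _⇔_; mk⇔; Equivalence)
open import Relation.Nullary using (¬_; yes; no)
open import Relation.Unary using (Pred)
open import Relation.Binary.PropositionalEquality using (_≡_; _≢_; refl; sym; trans; cong; cong₂; subst)
open import Algebra.Bundles using (CommutativeRing; CommutativeMonoid)

Reaches : ∀ {n} → (Fin n → Fin n) → Fin n → Fin n → Set
Reaches f x y = ∃[ k ] iter f k x ≡ y

iter-+ : ∀ {n} (f : Fin n → Fin n) k l x → iter f (k ℕ.+ l) x ≡ iter f k (iter f l x)
iter-+ f zero    l x = refl
iter-+ f (suc k) l x = cong f (iter-+ f k l x)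

reaches-refl : ∀ {n} {f : Fin n → Fin n} {x} → Reaches f x x
reaches-refl = 0 , refl

reaches-step : ∀ {n} {f : Fin n → Fin n} {x} → Reaches f x (f x)
reaches-step = 1 , refl

reaches-trans : ∀ {n} {f : Fin n → Fin n} {x y z} → Reaches f x y → Reaches f y z → Reaches f x z
reaches-trans {f = f} {x} (k , refl) (l , refl) = l ℕ.+ k , iter-+ f l k x

reaches-fixed : ∀ {n} {f : Fin n → Fin n} {x y} → f x ≡ x → Reaches f x y → x ≡ y
reaches-fixed fx (zero  , refl) = refl
reaches-fixed {f = f} fx (suc k , refl) = trans (sym fx) (cong f (reaches-fixed fx (k , refl)))

reaches-map : ∀ {m n} {f : Fin m → Fin m} {g : Fin n → Fin n} (φ : Fin m → Fin n) →
              (∀ x → Reaches g (φ x) (φ (f x))) →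
              ∀ {x y} → Reaches f x y → Reaches g (φ x) (φ y)
reaches-map φ simulate (zero  , refl) = reaches-refl
reaches-map {f = f} φ simulate {x} (suc k , refl) =
  reaches-trans (reaches-map φ simulate (k , refl)) (simulate (iter f k x))

collapse : ∀ {n} → Fin n → Fin (suc n) → Fin n
collapse a zero    = a
collapse a (suc y) = y

contract : ∀ {n} → (Fin (suc n) → Fin (suc n)) → Fin n → Fin n → Fin n
contract f a y = collapse a (f (suc y))

contract-fixes-last : ∀ {m} (f : Fin (suc (suc m)) → Fin (suc (suc m))) a →
                      f (fromℕ (suc m)) ≡ fromℕ (suc m) → contract f a (fromℕ m) ≡ fromℕ m
contract-fixes-last f a = cong (collapse a)

module _ {m} {f : Fin (suc (suc m)) → Fin (suc (suc m))} {a} (f0≡a+1 : f zero ≡ suc a) where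

  collapse-simulates : ∀ x → Reaches (contract f a) (collapse a x) (collapse a (f x))
  collapse-simulates zero    = 0 , cong (collapse a) (sym f0≡a+1)
  collapse-simulates (suc y) = reaches-step

  suc-simulates : ∀ y → Reaches f (suc y) (suc (contract f a y))
  suc-simulates y with f (suc y) in fy
  ... | zero  = reaches-trans (1 , fy) (1 , f0≡a+1)
  ... | suc x = 1 , fy

  potent⇔potent-contract : Potent (suc m) f ⇔ Potent m (contract f a)
  potent⇔potent-contract = mk⇔
    (λ pot y → reaches-map (collapse a) collapse-simulates (pot (suc y)))
    (λ pot → λ { zero    → reaches-trans (1 , f0≡a+1) (reaches-map suc suc-simulates (pot a))
               ; (suc y) → reaches-map suc suc-simulates (pot y) })

fixedZero⇒¬potent : ∀ {m} {f : Fin (suc (suc m)) → Fin (suc (suc m))} →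
                    f zero ≡ zero → ¬ Potent (suc m) f
fixedZero⇒¬potent f0≡0 pot with () ← reaches-fixed f0≡0 (pot zero)

potent-Fin1 : (f : Fin 1 → Fin 1) → Potent 0 f
potent-Fin1 f zero = reaches-refl

swapAdjacent : ∀ {n} → Fin n → Fin (suc n) → Fin (suc n)
swapAdjacent zero    zero          = suc zero
swapAdjacent zero    (suc zero)    = zero
swapAdjacent zero    (suc (suc j)) = suc (suc j)
swapAdjacent (suc k) zero          = zero
swapAdjacent (suc k) (suc j)       = suc (swapAdjacent k j)

swapAdjacent-inject₁ : ∀ {n} (k : Fin n) → swapAdjacent k (inject₁ k) ≡ suc k
swapAdjacent-inject₁ zero    = refl
swapAdjacent-inject₁ (suc k) = cong suc (swapAdjacent-inject₁ k)

swapAdjacent-suc : ∀ {n} (k : Fin n) → swapAdjacent k (suc k) ≡ inject₁ k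
swapAdjacent-suc zero    = refl
swapAdjacent-suc (suc k) = cong suc (swapAdjacent-suc k)

swapAdjacent-punchIn-inject₁ : ∀ {n} (k : Fin n) c →
                               swapAdjacent k (punchIn (inject₁ k) c) ≡ punchIn (suc k) c
swapAdjacent-punchIn-inject₁ zero    zero    = refl
swapAdjacent-punchIn-inject₁ zero    (suc c) = refl
swapAdjacent-punchIn-inject₁ (suc k) zero    = refl
swapAdjacent-punchIn-inject₁ (suc k) (suc c) = cong suc (swapAdjacent-punchIn-inject₁ k c)

swapAdjacent-punchIn-suc : ∀ {n} (k : Fin n) c →
                           swapAdjacent k (punchIn (suc k) c) ≡ punchIn (inject₁ k) c
swapAdjacent-punchIn-suc zero    zero    = refl
swapAdjacent-punchIn-suc zero    (suc c) = refl
swapAdjacent-punchIn-suc (suc k) zero    = refl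
swapAdjacent-punchIn-suc (suc k) (suc c) = cong suc (swapAdjacent-punchIn-suc k c)

swapAdjacent-other : ∀ {n} (k : Fin n) j → j ≢ inject₁ k → j ≢ suc k → swapAdjacent k j ≡ j
swapAdjacent-other zero    zero          j≢k j≢k+1 = ⊥-elim (j≢k refl)
swapAdjacent-other zero    (suc zero)    j≢k j≢k+1 = ⊥-elim (j≢k+1 refl)
swapAdjacent-other zero    (suc (suc j)) j≢k j≢k+1 = refl
swapAdjacent-other (suc k) zero          j≢k j≢k+1 = refl
swapAdjacent-other (suc k) (suc j)       j≢k j≢k+1 =
  cong suc (swapAdjacent-other k j (j≢k ∘ cong suc) (j≢k+1 ∘ cong suc))

swapAdjacent-punchIn-other :
  ∀ {n} (k : Fin (suc n)) j → j ≢ inject₁ k → j ≢ suc k →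
  ∃[ k′ ] ∀ c → swapAdjacent k (punchIn j c) ≡ punchIn j (swapAdjacent k′ c)
swapAdjacent-punchIn-other zero    zero       j≢k j≢k+1 = ⊥-elim (j≢k refl)
swapAdjacent-punchIn-other zero    (suc zero) j≢k j≢k+1 = ⊥-elim (j≢k+1 refl)
swapAdjacent-punchIn-other {suc n} zero (suc (suc j)) j≢k j≢k+1 =
  zero , λ { zero → refl ; (suc zero) → refl ; (suc (suc c)) → refl }
swapAdjacent-punchIn-other (suc k) zero j≢k j≢k+1 = k , λ c → refl
swapAdjacent-punchIn-other {suc n} (suc k) (suc j) j≢k j≢k+1
  with k′ , commute ← swapAdjacent-punchIn-other k j (j≢k ∘ cong suc) (j≢k+1 ∘ cong suc) =
  suc k′ , λ { zero → refl ; (suc c) → cong suc (commute c) }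

module _ {c ℓ : Level} (R : CommutativeRing c ℓ) where
  open CommutativeRing R
    renaming (refl to ≈-refl; sym to ≈-sym; trans to ≈-trans; reflexive to ≈-reflexive; zero to *-zero)
  open import Algebra.Properties.Ring ring using (-‿involutive; -‿distribʳ-*; -‿+-comm; -0#≈0#)
  open import Algebra.Properties.CommutativeSemigroup
    (CommutativeMonoid.commutativeSemigroup +-commutativeMonoid) using (interchange; x∙yz≈y∙xz)
  open import Algebra.Properties.CommutativeSemigroup
    (CommutativeMonoid.commutativeSemigroup *-commutativeMonoid)
    using () renaming (x∙yz≈y∙xz to x*[y*z]≈y*[x*z])
  open import Relation.Binary.Reasoning.Setoid setoid

  x-0≈x : ∀ x → x - 0# ≈ x
  x-0≈x x = ≈-trans (+-congˡ -0#≈0#) (+-identityʳ x)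

  x-y+y≈x : ∀ x y → (x - y) + y ≈ x
  x-y+y≈x x y = ≈-trans (+-assoc x (- y) y) (≈-trans (+-congˡ (-‿inverseˡ y)) (+-identityʳ x))

  x-ey+d[0-ew]≈x-e[y+dw] : ∀ x e y d w → (x - e * y) + d * (0# - e * w) ≈ x - e * (y + d * w)
  x-ey+d[0-ew]≈x-e[y+dw] x e y d w = begin
    (x - e * y) + d * (0# - e * w)   ≈⟨ +-congˡ (*-congˡ (+-identityˡ _)) ⟩
    (x - e * y) + d * - (e * w)      ≈⟨ +-congˡ (-‿distribʳ-* d (e * w)) ⟨
    (x - e * y) - d * (e * w)        ≈⟨ +-congˡ (-‿cong (x*[y*z]≈y*[x*z] d e w)) ⟩
    (x - e * y) - e * (d * w)        ≈⟨ +-assoc _ _ _ ⟩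
    x + (- (e * y) - e * (d * w))    ≈⟨ +-congˡ (-‿+-comm _ _) ⟩
    x - (e * y + e * (d * w))        ≈⟨ +-congˡ (-‿cong (distribˡ e y (d * w))) ⟨
    x - e * (y + d * w)              ∎

  ∑-cong : ∀ n {g h : Fin n → Carrier} → (∀ j → g j ≈ h j) → ∑ R n g ≈ ∑ R n h
  ∑-cong zero    g≈h = ≈-refl
  ∑-cong (suc n) g≈h = +-cong (g≈h zero) (∑-cong n (g≈h ∘ suc))

  ∑-distrib-+ : ∀ n (g h : Fin n → Carrier) → ∑ R n (λ j → g j + h j) ≈ ∑ R n g + ∑ R n h
  ∑-distrib-+ zero    g h = ≈-sym (+-identityʳ 0#)
  ∑-distrib-+ (suc n) g h =
    ≈-trans (+-congˡ (∑-distrib-+ n (g ∘ suc) (h ∘ suc))) (interchange _ _ _ _)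

  ∑-neg : ∀ n (g : Fin n → Carrier) → ∑ R n (λ j → - g j) ≈ - ∑ R n g
  ∑-neg zero    g = ≈-sym -0#≈0#
  ∑-neg (suc n) g = ≈-trans (+-congˡ (∑-neg n (g ∘ suc))) (-‿+-comm _ _)

  ∑-zero : ∀ n (g : Fin n → Carrier) → (∀ j → g j ≈ 0#) → ∑ R n g ≈ 0#
  ∑-zero zero    g g≈0 = ≈-refl
  ∑-zero (suc n) g g≈0 =
    ≈-trans (+-cong (g≈0 zero) (∑-zero n (g ∘ suc) (g≈0 ∘ suc))) (+-identityˡ 0#)

  ∑-head : ∀ n (g : Fin (suc n) → Carrier) → (∀ j → g (suc j) ≈ 0#) → ∑ R (suc n) g ≈ g zero
  ∑-head n g g≈0 = ≈-trans (+-congˡ (∑-zero n (g ∘ suc) g≈0)) (+-identityʳ _)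

  ∑-swapAdjacent : ∀ n (g : Fin (suc n) → Carrier) k →
                   ∑ R (suc n) (g ∘ swapAdjacent k) ≈ ∑ R (suc n) g
  ∑-swapAdjacent (suc n) g zero    = x∙yz≈y∙xz _ _ _
  ∑-swapAdjacent (suc n) g (suc k) = +-congˡ (∑-swapAdjacent n (g ∘ suc) k)

  ∑-adjacentCancel : ∀ n (g : Fin (suc n) → Carrier) k →
                     (∀ j → j ≢ inject₁ k → j ≢ suc k → g j ≈ 0#) →
                     g (inject₁ k) + g (suc k) ≈ 0# → ∑ R (suc n) g ≈ 0#
  ∑-adjacentCancel (suc n) g zero others cancel = begin
    g zero + (g (suc zero) + ∑ R n (λ j → g (suc (suc j))))
      ≈⟨ +-congˡ (+-congˡ (∑-zero n _ λ j → others (suc (suc j)) (λ ()) (λ ()))) ⟩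
    g zero + (g (suc zero) + 0#)  ≈⟨ +-congˡ (+-identityʳ _) ⟩
    g zero + g (suc zero)         ≈⟨ cancel ⟩
    0#                            ∎
  ∑-adjacentCancel (suc n) g (suc k) others cancel =
    ≈-trans (+-cong (others zero (λ ()) (λ ()))
                    (∑-adjacentCancel n (g ∘ suc) k
                      (λ j j≢k j≢k+1 →
                         others (suc j) (j≢k ∘ suc-injective) (j≢k+1 ∘ suc-injective))
                      cancel))
            (+-identityˡ 0#)

  signed-cong : ∀ {n} (j : Fin n) {x y} → x ≈ y → signed R j x ≈ signed R j y
  signed-cong zero    x≈y = x≈y
  signed-cong (suc j) x≈y = -‿cong (signed-cong j x≈y)

  signed-neg : ∀ {n} (j : Fin n) x → signed R j (- x) ≈ - signed R j x
  signed-neg zero    x = ≈-refl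
  signed-neg (suc j) x = -‿cong (signed-neg j x)

  signed-+ : ∀ {n} (j : Fin n) x y → signed R j (x + y) ≈ signed R j x + signed R j y
  signed-+ zero    x y = ≈-refl
  signed-+ (suc j) x y = ≈-trans (-‿cong (signed-+ j x y)) (≈-sym (-‿+-comm _ _))

  signed-zero : ∀ {n} (j : Fin n) → signed R j 0# ≈ 0#
  signed-zero zero    = ≈-refl
  signed-zero (suc j) = ≈-trans (-‿cong (signed-zero j)) -0#≈0#

  signed-inject₁ : ∀ {n} (k : Fin n) x → signed R (inject₁ k) x ≡ signed R k x
  signed-inject₁ zero    x = refl
  signed-inject₁ (suc k) x = cong -_ (signed-inject₁ k x)

  Matrix : ℕ → Set c
  Matrix n = Fin n → Fin n → Carrier

  minor : ∀ {n} → Matrix (suc n) → Fin (suc n) → Matrix n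
  minor A j i k = A (suc i) (punchIn j k)

  laplaceSummand : ∀ {n} → Matrix (suc n) → Fin (suc n) → Carrier
  laplaceSummand {n} A j = A zero j * det R n (minor A j)

  laplaceTerm : ∀ {n} → Matrix (suc n) → Fin (suc n) → Carrier
  laplaceTerm A j = signed R j (laplaceSummand A j)

  det-cong : ∀ n {A B : Matrix n} → (∀ i j → A i j ≈ B i j) → det R n A ≈ det R n B
  det-cong zero    A≈B = ≈-refl
  det-cong (suc n) A≈B = ∑-cong (suc n) λ j →
    signed-cong j (*-cong (A≈B zero j) (det-cong n λ i k → A≈B (suc i) (punchIn j k)))

  laplaceSummand-cong : ∀ {n} (A B : Matrix (suc n)) {j j′} → A zero j ≈ B zero j′ →
                        (∀ i c → A (suc i) (punchIn j c) ≈ B (suc i) (punchIn j′ c)) →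
                        laplaceSummand A j ≈ laplaceSummand B j′
  laplaceSummand-cong {n} A B top≈ minor≈ = *-cong top≈ (det-cong n minor≈)

  det-swapAdjacentColumns : ∀ n (A B : Matrix (suc n)) k →
                            (∀ i j → B i j ≈ A i (swapAdjacent k j)) →
                            det R (suc n) B ≈ - det R (suc n) A
  det-swapAdjacentColumns (suc n) A B k B≈Aσ = begin
    ∑ R (suc (suc n)) (laplaceTerm B)
      ≈⟨ ∑-cong (suc (suc n)) term ⟩
    ∑ R (suc (suc n)) (λ j → - laplaceTerm A (swapAdjacent k j))
      ≈⟨ ∑-neg (suc (suc n)) (laplaceTerm A ∘ swapAdjacent k) ⟩
    - ∑ R (suc (suc n)) (laplaceTerm A ∘ swapAdjacent k)
      ≈⟨ -‿cong (∑-swapAdjacent (suc n) (laplaceTerm A) k) ⟩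
    - ∑ R (suc (suc n)) (laplaceTerm A) ∎
    where
    B≈A : ∀ {i j j′} → swapAdjacent k j ≡ j′ → B i j ≈ A i j′
    B≈A {i} {j} σj≡j′ = ≈-trans (B≈Aσ i j) (≈-reflexive (cong (A i) σj≡j′))

    term : ∀ j → laplaceTerm B j ≈ - laplaceTerm A (swapAdjacent k j)
    term j with j ≟ inject₁ k | j ≟ suc k
    ... | yes refl | _ rewrite swapAdjacent-inject₁ k | signed-inject₁ k (laplaceSummand B (inject₁ k)) =
      ≈-trans (signed-cong k (laplaceSummand-cong B A (B≈A (swapAdjacent-inject₁ k))
                                                      (λ i c → B≈A (swapAdjacent-punchIn-inject₁ k c))))
              (≈-sym (-‿involutive _))
    ... | no _ | yes refl rewrite swapAdjacent-suc k | signed-inject₁ k (laplaceSummand A (inject₁ k)) =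
      -‿cong (signed-cong k (laplaceSummand-cong B A (B≈A (swapAdjacent-suc k))
                                                     (λ i c → B≈A (swapAdjacent-punchIn-suc k c))))
    ... | no j≢k | no j≢k+1
      with k′ , commute ← swapAdjacent-punchIn-other k j j≢k j≢k+1
      rewrite swapAdjacent-other k j j≢k j≢k+1 = begin
        signed R j (B zero j * det R (suc n) (minor B j))
          ≈⟨ signed-cong j (*-cong (B≈A (swapAdjacent-other k j j≢k j≢k+1)) minor-swapped) ⟩
        signed R j (A zero j * - det R (suc n) (minor A j))
          ≈⟨ signed-cong j (≈-sym (-‿distribʳ-* _ _)) ⟩
        signed R j (- laplaceSummand A j)
          ≈⟨ signed-neg j _ ⟩
        - laplaceTerm A j ∎
      where
      minor-swapped = det-swapAdjacentColumns n (minor A j) (minor B j) k′ λ i c → B≈A (commute c)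

  swapAdjacent-invariant⇒det≈0 : ∀ n (A : Matrix (suc n)) k →
                                 (∀ i j → A i (swapAdjacent k j) ≈ A i j) → det R (suc n) A ≈ 0#
  swapAdjacent-invariant⇒det≈0 (suc n) A k Aσ≈A =
    ∑-adjacentCancel (suc n) (laplaceTerm A) k others cancel
    where
    A≈A : ∀ {i j j′} → swapAdjacent k j′ ≡ j → A i j ≈ A i j′
    A≈A {i} σj′≡j = ≈-trans (≈-reflexive (cong (A i) (sym σj′≡j))) (Aσ≈A i _)

    others : ∀ j → j ≢ inject₁ k → j ≢ suc k → laplaceTerm A j ≈ 0#
    others j j≢k j≢k+1 with k′ , commute ← swapAdjacent-punchIn-other k j j≢k j≢k+1 =
      ≈-trans (signed-cong j (≈-trans (*-congˡ minor≈0) (zeroʳ _))) (signed-zero j)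
      where
      minor≈0 = swapAdjacent-invariant⇒det≈0 n (minor A j) k′ λ i c → A≈A (commute c)

    cancel : laplaceTerm A (inject₁ k) + laplaceTerm A (suc k) ≈ 0#
    cancel rewrite signed-inject₁ k (laplaceSummand A (inject₁ k)) =
      ≈-trans (+-congˡ (-‿cong (signed-cong k summand≈))) (-‿inverseʳ _)
      where
      summand≈ = laplaceSummand-cong A A (A≈A (swapAdjacent-inject₁ k))
                                         (λ i c → A≈A (swapAdjacent-punchIn-inject₁ k c))

  -- Induction on k: swapping columns k and k + 1 moves the copy of column 0 from k + 1 to k.
  equalColumns₀⇒det≈0 : ∀ {n} (A : Matrix (suc n)) k →
                        (∀ i → A i zero ≈ A i (suc k)) → det R (suc n) A ≈ 0#
  equalColumns₀⇒det≈0 {suc n} A k = <-weakInduction P base step k A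
    where
    P : Pred (Fin (suc n)) (c ⊔ ℓ)
    P k = ∀ A → (∀ i → A i zero ≈ A i (suc k)) → det R (suc (suc n)) A ≈ 0#

    base : P zero
    base A col₀≈col₁ = swapAdjacent-invariant⇒det≈0 (suc n) A zero λ where
      i zero          → ≈-sym (col₀≈col₁ i)
      i (suc zero)    → col₀≈col₁ i
      i (suc (suc j)) → ≈-refl

    step : ∀ k → P (inject₁ k) → P (suc k)
    step k hyp A col₀≈col = begin
      det R (suc (suc n)) A      ≈⟨ -‿involutive _ ⟨
      - - det R (suc (suc n)) A  ≈⟨ -‿cong (det-swapAdjacentColumns (suc n) A B (suc k) λ _ _ → ≈-refl) ⟨
      - det R (suc (suc n)) B    ≈⟨ -‿cong (hyp B λ i → ≈-trans (col₀≈col i) (moved i)) ⟩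
      - 0#                       ≈⟨ -0#≈0# ⟩
      0#                         ∎
      where
      B : Matrix (suc (suc n))
      B i j = A i (swapAdjacent (suc k) j)

      moved : ∀ i → A i (suc (suc k)) ≈ B i (suc (inject₁ k))
      moved i = ≈-reflexive (cong (A i ∘ suc) (sym (swapAdjacent-inject₁ k)))

  det-linearColumn : ∀ n (A B C : Matrix n) a →
                     (∀ i j → j ≢ a → A i j ≈ C i j) → (∀ i j → j ≢ a → B i j ≈ C i j) →
                     (∀ i → C i a ≈ A i a + B i a) → det R n C ≈ det R n A + det R n B
  det-linearColumn (suc n) A B C a A≈C B≈C Ca≈Aa+Ba = begin
    ∑ R (suc n) (laplaceTerm C)
      ≈⟨ ∑-cong (suc n) (λ j → ≈-trans (signed-cong j (summand j)) (signed-+ j _ _)) ⟩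
    ∑ R (suc n) (λ j → laplaceTerm A j + laplaceTerm B j)
      ≈⟨ ∑-distrib-+ (suc n) (laplaceTerm A) (laplaceTerm B) ⟩
    ∑ R (suc n) (laplaceTerm A) + ∑ R (suc n) (laplaceTerm B) ∎
    where
    summand : ∀ j → laplaceSummand C j ≈ laplaceSummand A j + laplaceSummand B j
    summand j with j ≟ a
    ... | yes refl = ≈-trans (*-congʳ (Ca≈Aa+Ba zero)) (≈-trans (distribʳ _ _ _)
                       (+-cong (*-congˡ (det-cong n (same-minor A≈C))) (*-congˡ (det-cong n (same-minor B≈C)))))
      where
      same-minor : ∀ {X} → (∀ i j → j ≢ a → X i j ≈ C i j) → ∀ i c → minor C a i c ≈ minor X a i c
      same-minor X≈C i c = ≈-sym (X≈C (suc i) (punchIn a c) (punchInᵢ≢i a c))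
    ... | no j≢a = ≈-trans (*-congˡ minor-linear) (≈-trans (distribˡ _ _ _)
                     (+-cong (*-congʳ (≈-sym (A≈C zero j j≢a))) (*-congʳ (≈-sym (B≈C zero j j≢a)))))
      where
      a′ = punchOut j≢a

      avoids-a : ∀ c → c ≢ a′ → punchIn j c ≢ a
      avoids-a c c≢a′ eq = c≢a′ (punchIn-injective j c a′ (trans eq (sym (punchIn-punchOut j≢a))))

      minor-linear : det R n (minor C j) ≈ det R n (minor A j) + det R n (minor B j)
      minor-linear = det-linearColumn n (minor A j) (minor B j) (minor C j) a′
        (λ i c c≢a′ → A≈C (suc i) (punchIn j c) (avoids-a c c≢a′))
        (λ i c c≢a′ → B≈C (suc i) (punchIn j c) (avoids-a c c≢a′))
        (λ i → subst (λ x → C (suc i) x ≈ A (suc i) x + B (suc i) x)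
                     (sym (punchIn-punchOut j≢a)) (Ca≈Aa+Ba (suc i)))

  zeroRow₀⇒det≈0 : ∀ n (A : Matrix (suc n)) → (∀ j → A zero j ≈ 0#) → det R (suc n) A ≈ 0#
  zeroRow₀⇒det≈0 n A row≈0 = ∑-zero (suc n) (laplaceTerm A) λ j →
    ≈-trans (signed-cong j (≈-trans (*-congʳ (row≈0 j)) (zeroˡ _))) (signed-zero j)

  det-unitRow₀ : ∀ n (A : Matrix (suc n)) → A zero zero ≈ 1# → (∀ j → A zero (suc j) ≈ 0#) →
                 det R (suc n) A ≈ det R n (minor A zero)
  det-unitRow₀ n A A₀₀≈1 row≈0 =
    ≈-trans (∑-head n (laplaceTerm A) rest≈0) (≈-trans (*-congʳ A₀₀≈1) (*-identityˡ _))
    where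
    rest≈0 : ∀ j → laplaceTerm A (suc j) ≈ 0#
    rest≈0 j = ≈-trans (signed-cong (suc j) (≈-trans (*-congʳ (row≈0 j)) (zeroˡ _))) (signed-zero (suc j))

  δ-refl : ∀ {n} (i : Fin n) → δ R i i ≡ 1#
  δ-refl i with i ≟ i
  ... | yes _   = refl
  ... | no i≢i = ⊥-elim (i≢i refl)

  δ-≢ : ∀ {n} {i j : Fin n} → i ≢ j → δ R i j ≡ 0#
  δ-≢ {i = i} {j} i≢j with i ≟ j
  ... | yes i≡j = ⊥-elim (i≢j i≡j)
  ... | no _    = refl

  δ-suc : ∀ {n} (i j : Fin n) → δ R (suc i) (suc j) ≡ δ R i j
  δ-suc i j with i ≟ j
  ... | yes _ = refl
  ... | no _  = refl

  δ-collapse : ∀ {n} (a : Fin n) z c → δ R (collapse a z) c ≈ δ R z (suc c) + δ R a c * δ R z zero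
  δ-collapse a zero    c = ≈-sym (≈-trans (+-identityˡ _) (*-identityʳ _))
  δ-collapse a (suc w) c = begin
    δ R w c                            ≡⟨ δ-suc w c ⟨
    δ R (suc w) (suc c)                ≈⟨ +-identityʳ _ ⟨
    δ R (suc w) (suc c) + 0#           ≈⟨ +-congˡ (zeroʳ _) ⟨
    δ R (suc w) (suc c) + δ R a c * 0# ∎

  det-addColumn₀ : ∀ n (A : Matrix (suc n)) k →
                   det R (suc n) (λ i j → A i j + δ R (suc k) j * A i zero) ≈ det R (suc n) A
  det-addColumn₀ n A k = begin
    det R (suc n) C                    ≈⟨ det-linearColumn (suc n) A B C (suc k) A≈C B≈C added ⟩
    det R (suc n) A + det R (suc n) B  ≈⟨ +-congˡ (equalColumns₀⇒det≈0 B k B-equalColumns) ⟩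
    det R (suc n) A + 0#               ≈⟨ +-identityʳ _ ⟩
    det R (suc n) A                    ∎
    where
    B C : Matrix (suc n)
    B i = updateAt (A i) (suc k) λ _ → A i zero
    C i j = A i j + δ R (suc k) j * A i zero

    B-equalColumns : ∀ i → B i zero ≈ B i (suc k)
    B-equalColumns i = ≈-reflexive (sym (updateAt-updates (suc k) {λ _ → A i zero} (A i)))

    A≈C : ∀ i j → j ≢ suc k → A i j ≈ C i j
    A≈C i j j≢k+1 = ≈-sym (begin
      A i j + δ R (suc k) j * A i zero  ≡⟨ cong (λ d → A i j + d * A i zero) (δ-≢ (j≢k+1 ∘ sym)) ⟩
      A i j + 0# * A i zero             ≈⟨ +-congˡ (zeroˡ _) ⟩
      A i j + 0#                        ≈⟨ +-identityʳ _ ⟩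
      A i j                             ∎)

    B≈C : ∀ i j → j ≢ suc k → B i j ≈ C i j
    B≈C i j j≢k+1 =
      ≈-trans (≈-reflexive (updateAt-minimal j (suc k) {λ _ → A i zero} (A i) j≢k+1)) (A≈C i j j≢k+1)

    added : ∀ i → C i (suc k) ≈ A i (suc k) + B i (suc k)
    added i = +-congˡ (begin
      δ R (suc k) (suc k) * A i zero ≡⟨ cong (_* A i zero) (δ-refl (suc k)) ⟩
      1# * A i zero                  ≈⟨ *-identityˡ _ ⟩
      A i zero                       ≈⟨ B-equalColumns i ⟩
      B i (suc k)                    ∎)

  Zmat-row : ∀ m (f : Fin (suc m) → Fin (suc m)) i j → i ≢ fromℕ m →
             Zmat R m f i j ≈ δ R i j - δ R (f i) j
  Zmat-row m f i j i≢last = begin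
    δ R i j - (1# - δ R i (fromℕ m)) * δ R (f i) j
      ≡⟨ cong (λ d → δ R i j - (1# - d) * δ R (f i) j) (δ-≢ i≢last) ⟩
    δ R i j - (1# - 0#) * δ R (f i) j
      ≈⟨ +-congˡ (-‿cong (≈-trans (*-congʳ (x-0≈x 1#)) (*-identityˡ _))) ⟩
    δ R i j - δ R (f i) j ∎

  det-Zmat-1×1 : (f : Fin 1 → Fin 1) → det R 1 (Zmat R 0 f) ≈ 1#
  det-Zmat-1×1 f = det-unitRow₀ 0 (Zmat R 0 f) Z₀₀≈1 λ ()
    where
    Z₀₀≈1 : 1# - (1# - 1#) * δ R (f zero) zero ≈ 1#
    Z₀₀≈1 = begin
      1# - (1# - 1#) * δ R (f zero) zero  ≈⟨ +-congˡ (-‿cong (*-congʳ (-‿inverseʳ 1#))) ⟩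
      1# - 0# * δ R (f zero) zero         ≈⟨ +-congˡ (-‿cong (zeroˡ _)) ⟩
      1# - 0#                             ≈⟨ x-0≈x 1# ⟩
      1#                                  ∎

  fixedZero⇒det-Zmat≈0 : ∀ m (f : Fin (suc (suc m)) → Fin (suc (suc m))) → f zero ≡ zero →
                         det R (suc (suc m)) (Zmat R (suc m) f) ≈ 0#
  fixedZero⇒det-Zmat≈0 m f f0≡0 = zeroRow₀⇒det≈0 (suc m) (Zmat R (suc m) f) λ j → begin
    Zmat R (suc m) f zero j     ≈⟨ Zmat-row (suc m) f zero j (λ ()) ⟩
    δ R zero j - δ R (f zero) j ≡⟨ cong (λ z → δ R zero j - δ R z j) f0≡0 ⟩
    δ R zero j - δ R zero j     ≈⟨ -‿inverseʳ _ ⟩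
    0#                          ∎

  det-Zmat-contract : ∀ m (f : Fin (suc (suc m)) → Fin (suc (suc m))) a → f zero ≡ suc a →
                      det R (suc (suc m)) (Zmat R (suc m) f) ≈ det R (suc m) (Zmat R m (contract f a))
  det-Zmat-contract m f a f0≡a+1 = begin
    det R (suc (suc m)) Z
      ≈⟨ det-addColumn₀ (suc m) Z a ⟨
    det R (suc (suc m)) C
      ≈⟨ det-unitRow₀ (suc m) C (C-row₀ zero) (C-row₀ ∘ suc) ⟩
    det R (suc m) (minor C zero)
      ≈⟨ det-cong (suc m) minor-C ⟩
    det R (suc m) (Zmat R m (contract f a)) ∎
    where
    Z C : Matrix (suc (suc m))
    Z = Zmat R (suc m) f
    C i j = Z i j + δ R (suc a) j * Z i zero

    C-row₀ : ∀ j → C zero j ≈ δ R zero j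
    C-row₀ j = begin
      Z zero j + δ R (suc a) j * Z zero zero
        ≈⟨ +-cong (Zmat-row (suc m) f zero j (λ ())) (*-congˡ (Zmat-row (suc m) f zero zero (λ ()))) ⟩
      (δ R zero j - δ R (f zero) j) + δ R (suc a) j * (1# - δ R (f zero) zero)
        ≡⟨ cong (λ z → (δ R zero j - δ R z j) + δ R (suc a) j * (1# - δ R z zero)) f0≡a+1 ⟩
      (δ R zero j - δ R (suc a) j) + δ R (suc a) j * (1# - 0#)
        ≈⟨ +-congˡ (≈-trans (*-congˡ (x-0≈x 1#)) (*-identityʳ _)) ⟩
      (δ R zero j - δ R (suc a) j) + δ R (suc a) j
        ≈⟨ x-y+y≈x _ _ ⟩
      δ R zero j ∎

    minor-C : ∀ i c → minor C zero i c ≈ Zmat R m (contract f a) i c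
    minor-C i c = begin
      (δ R (suc i) (suc c) - (1# - δ R (suc i) (suc (fromℕ m))) * y)
        + δ R (suc a) (suc c) * (0# - (1# - δ R (suc i) (suc (fromℕ m))) * w)
        ≡⟨ cong (λ d → (δ R (suc i) (suc c) - (1# - d) * y)
                         + δ R (suc a) (suc c) * (0# - (1# - d) * w)) (δ-suc i (fromℕ m)) ⟩
      (δ R (suc i) (suc c) - e * y) + δ R (suc a) (suc c) * (0# - e * w)
        ≡⟨ cong₂ (λ x d → (x - e * y) + d * (0# - e * w)) (δ-suc i c) (δ-suc a c) ⟩
      (δ R i c - e * y) + δ R a c * (0# - e * w)
        ≈⟨ x-ey+d[0-ew]≈x-e[y+dw] _ _ _ _ _ ⟩
      δ R i c - e * (y + δ R a c * w)
        ≈⟨ +-congˡ (-‿cong (*-congˡ (δ-collapse a z c))) ⟨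
      δ R i c - e * δ R (collapse a z) c ∎
      where
      z = f (suc i)
      y = δ R z (suc c)
      w = δ R z zero
      e = 1# - δ R i (fromℕ m)

  -- The case split on f 0 is done through an equation rather than `with`, which would also
  -- abstract f 0 inside the unfolded determinant.
  potent⇒det-Zmat≈1 : ∀ m (f : Fin (suc m) → Fin (suc m)) → f (fromℕ m) ≡ fromℕ m →
                      Potent m f → det R (suc m) (Zmat R m f) ≈ 1#
  potent⇒det-Zmat≈1 zero    f _   _   = det-Zmat-1×1 f
  potent⇒det-Zmat≈1 (suc m) f fix pot = by-f0 (f zero) refl
    where
    by-f0 : ∀ z → f zero ≡ z → det R (suc (suc m)) (Zmat R (suc m) f) ≈ 1#
    by-f0 zero    f0≡0   = ⊥-elim (fixedZero⇒¬potent f0≡0 pot)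
    by-f0 (suc a) f0≡a+1 = ≈-trans (det-Zmat-contract m f a f0≡a+1)
      (potent⇒det-Zmat≈1 m (contract f a) (contract-fixes-last f a fix)
                         (Equivalence.to (potent⇔potent-contract f0≡a+1) pot))

  ¬potent⇒det-Zmat≈0 : ∀ m (f : Fin (suc m) → Fin (suc m)) → f (fromℕ m) ≡ fromℕ m →
                       ¬ Potent m f → det R (suc m) (Zmat R m f) ≈ 0#
  ¬potent⇒det-Zmat≈0 zero    f _   ¬pot = ⊥-elim (¬pot (potent-Fin1 f))
  ¬potent⇒det-Zmat≈0 (suc m) f fix ¬pot = by-f0 (f zero) refl
    where
    by-f0 : ∀ z → f zero ≡ z → det R (suc (suc m)) (Zmat R (suc m) f) ≈ 0#
    by-f0 zero    f0≡0   = fixedZero⇒det-Zmat≈0 m f f0≡0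
    by-f0 (suc a) f0≡a+1 = ≈-trans (det-Zmat-contract m f a f0≡a+1)
      (¬potent⇒det-Zmat≈0 m (contract f a) (contract-fixes-last f a fix)
                          (¬pot ∘ Equivalence.from (potent⇔potent-contract f0≡a+1)))

proposition3p13 : ∀ {c ℓ : Level} (R : CommutativeRing c ℓ) (m : ℕ)
                  (f : Fin (suc m) → Fin (suc m)) → f (fromℕ m) ≡ fromℕ m →
                  (Potent m f → CommutativeRing._≈_ R (det R (suc m) (Zmat R m f)) (CommutativeRing.1# R))
                  × (¬ Potent m f → CommutativeRing._≈_ R (det R (suc m) (Zmat R m f)) (CommutativeRing.0# R))
proposition3p13 R m f fix = potent⇒det-Zmat≈1 R m f fix , ¬potent⇒det-Zmat≈0 R m f fix
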